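{- Define morphisms $f,g:\{0,1,2\}^*\to\{0,1,2\}^*$ by $f(0)=01,\ f(1)=022,\ f(2)=02$ and $g(0)=20,\ g(1)=21,\ g(2)=2$. Let $\mathbf{x}=f^\omega(0)$ be the fixed point of $f$ starting with $0$, and let $\mathbf{y}=g(\mathbf{x})=y_0y_1y_2\cdots$. Let $A=00101101$, $B=001$, $C=00202202$, $D=002$, and let $\mathbf{z}=\tau(y_0)\tau(y_1)\tau(y_2)\cdots$, where for every $i\ge 0$: $\tau(y_{2i})=B$ if $y_{2i}=0$, $\tau(y_{2i})=A$ if $y_{2i}=1$, $\tau(y_{2i})=AA$ if $y_{2i}=2$; and $\tau(y_{2i+1})=D$ if $y_{2i+1}=0$, $\tau(y_{2i+1})=C$ if $y_{2i+1}=1$, $\tau(y_{2i+1})=CC$ if $y_{2i+1}=2$. Let $\varphi:\{0,1,2,3,4\}^*\to\{0,1,2,3,4\}^*$ be the morphism $\varphi(0)=01,\ \varphi(1)=02,\ \varphi(2)=03,\ \varphi(3)=04,\ \varphi(4)=044$, and let $\xi:\{0,1,2,3,4\}^*\to\{0,1,2\}^*$ be the morphism $\xi(0)=A,\ \xi(1)=AD,\ \xi(2)=AC,\ \xi(3)=ACC,\ \xi(4)=ACCBCC$. Then $\mathbf{z}=\xi(\varphi^\omega(0))$, where $\varphi^\omega(0)$ is the fixed point of $\varphi$ starting with $0$. In particular, $\mathbf{z}$ is uniformly recurrent.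
   Context: For a morphism $h$ with $h(j)=jw$ for a letter $j$ and nonempty word $w$ (and no letter mapped to the empty word), $h^\omega(j)$ denotes the unique infinite sequence having $h^n(j)$ as a prefix for all $n$; morphisms are extended to infinite sequences letter by letter. A sequence is uniformly recurrent if for every $n$ there is $N$ such that every factor of length $N$ contains all factors of length $n$. -}

module Defs where

open import Data.Nat using (ℕ; zero; suc; _+_; _<_; _≤_)
open import Data.Nat.DivMod using (_%_)
open import Data.Fin using (Fin; zero; suc)
open import Data.List using (List; []; _∷_; _++_; concatMap)
open import Data.Product using (Σ; ∃; _×_; _,_)
open import Relation.Binary.PropositionalEquality using (_≡_)
open import Function using (_∘_)

Seq : Set → Set
Seq A = ℕ → A

Morphism : ℕ → ℕ → Set
Morphism k m = Fin k → List (Fin m)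

applyW : ∀ {k m} → Morphism k m → List (Fin k) → List (Fin m)
applyW h = concatMap h

iterW : ∀ {k} → Morphism k k → ℕ → List (Fin k) → List (Fin k)
iterW h zero    w = w
iterW h (suc n) w = applyW h (iterW h n w)

lookupD : ∀ {A : Set} → A → List A → ℕ → A
lookupD d []       _       = d
lookupD d (a ∷ _)  zero    = a
lookupD d (_ ∷ as) (suc i) = lookupD d as i

prefix : ∀ {A : Set} → Seq A → ℕ → List A
prefix s zero    = []
prefix s (suc n) = s zero ∷ prefix (s ∘ suc) n

-- h^ω(j): for h(j) = j w with w nonempty, |h^(i+1)(j)| ≥ i+2, and the
-- i-th letter of h^ω(j) is the i-th letter of h^(i+1)(j).
fixPt : ∀ {k} → Morphism k k → Fin k → Seq (Fin k)
fixPt h j i = lookupD j (iterW h (suc i) (j ∷ [])) i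

-- Image of an infinite sequence under a non-erasing morphism (letter by letter):
-- the i-th letter of h(s) is the i-th letter of h(s_0 … s_i).
applyS : ∀ {k m} → Morphism k m → Fin m → Seq (Fin k) → Seq (Fin m)
applyS h d s i = lookupD d (applyW h (prefix s (suc i))) i

UniformlyRecurrent : ∀ {A : Set} → Seq A → Set
UniformlyRecurrent s =
  ∀ n → ∃ λ N → ∀ i j →
    ∃ λ k → (k + n ≤ N) × (∀ t → t < n → s (j + t) ≡ s (i + k + t))

c0 c1 c2 : Fin 3
c0 = zero
c1 = suc zero
c2 = suc (suc zero)

d0 d1 d2 d3 d4 : Fin 5
d0 = zero
d1 = suc zero
d2 = suc (suc zero)
d3 = suc (suc (suc zero))
d4 = suc (suc (suc (suc zero)))

f : Morphism 3 3
f zero             = c0 ∷ c1 ∷ []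
f (suc zero)       = c0 ∷ c2 ∷ c2 ∷ []
f (suc (suc zero)) = c0 ∷ c2 ∷ []

g : Morphism 3 3
g zero             = c2 ∷ c0 ∷ []
g (suc zero)       = c2 ∷ c1 ∷ []
g (suc (suc zero)) = c2 ∷ []

x : Seq (Fin 3)
x = fixPt f c0

y : Seq (Fin 3)
y = applyS g c0 x

wA wB wC wD : List (Fin 3)
wA = c0 ∷ c0 ∷ c1 ∷ c0 ∷ c1 ∷ c1 ∷ c0 ∷ c1 ∷ []
wB = c0 ∷ c0 ∷ c1 ∷ []
wC = c0 ∷ c0 ∷ c2 ∷ c0 ∷ c2 ∷ c2 ∷ c0 ∷ c2 ∷ []
wD = c0 ∷ c0 ∷ c2 ∷ []

τ : ℕ → Fin 3 → List (Fin 3)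
τ i a with i % 2
τ i zero             | zero  = wB
τ i (suc zero)       | zero  = wA
τ i (suc (suc zero)) | zero  = wA ++ wA
τ i zero             | suc _ = wD
τ i (suc zero)       | suc _ = wC
τ i (suc (suc zero)) | suc _ = wC ++ wC

τPrefix : ℕ → List (Fin 3)
τPrefix zero    = []
τPrefix (suc n) = τPrefix n ++ τ n (y n)

-- z = τ(y_0) τ(y_1) …; every τ-block is nonempty, so letter i lies in τPrefix (i+1).
z : Seq (Fin 3)
z i = lookupD c0 (τPrefix (suc i)) i

φ : Morphism 5 5
φ zero                         = d0 ∷ d1 ∷ []
φ (suc zero)                   = d0 ∷ d2 ∷ []
φ (suc (suc zero))             = d0 ∷ d3 ∷ []
φ (suc (suc (suc zero)))       = d0 ∷ d4 ∷ []
φ (suc (suc (suc (suc zero)))) = d0 ∷ d4 ∷ d4 ∷ []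

ξ : Morphism 5 3
ξ zero                         = wA
ξ (suc zero)                   = wA ++ wD
ξ (suc (suc zero))             = wA ++ wC
ξ (suc (suc (suc zero)))       = wA ++ wC ++ wC
ξ (suc (suc (suc (suc zero)))) = wA ++ wC ++ wC ++ wB ++ wC ++ wC

-- Annotate every letter of x with the parity of the position of y at which its
-- g-image begins. Since |g(f(a))| and |g(a)| have the same parity, f lifts to a morphism f̂ of
-- annotated letters, and τ ∘ g to a morphism τĝ of annotated letters. The morphism σ
-- conjugates φ to f̂ (σ ∘ φ = f̂ ∘ σ) and satisfies τĝ ∘ σ = ξ ∘ φ, so
-- τ(g(fⁿ(0))) = τĝ(f̂ⁿ(σ(0))) = τĝ(σ(φⁿ(0))) = ξ(φⁿ⁺¹(0)), whence z = ξ(φ^ω(0)).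
--
-- Uniform recurrence holds for the image s = ξ(u) of the fixed point u of any expanding
-- morphism φ under a non-erasing ξ, provided some K makes every two-letter factor ab of u occur
-- in φ^K(c) for every letter c. Writing s as the concatenation of the blocks ξφᴹ(uᵢ), a factor
-- of length n of s lies in ξφⁿ(ab) for a two-letter factor ab of u, and since ξφⁿ⁺ᴷ(c) contains
-- ξφⁿ(ab) for every c, an occurrence of it starts within 2·max_c |ξφⁿ⁺ᴷ(c)| of any position.
-- For φ the two-letter factors are among 0a, a0 (a ≠ 0) and 44, which all occur in φ⁵(c).

module Submission where

open import Defs
open import Data.Nat using (ℕ; zero; suc; _+_; _∸_; _⊔_; _≤_; _<_; z≤n; s≤s; _<?_; _≤?_; parity)
open import Data.Nat.Properties
open import Data.Nat.Solver using (module +-*-Solver)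
open +-*-Solver using (solve; _:+_; _:=_)
open import Data.Parity.Base using (Parity; 0ℙ; 1ℙ) renaming (_+_ to _+ℙ_; _⁻¹ to _⁻¹ℙ)
open import Data.Parity.Properties using (⁻¹-selfInverse; suc-homo-⁻¹)
open import Data.Fin using (Fin; zero; suc) renaming (_≟_ to _≟ᶠ_)
open import Data.Fin.Properties using (all?)
open import Data.List using (List; []; _∷_; _++_; length; concatMap)
open import Data.List.Properties using (length-++; length-++-≤ˡ; ++-assoc; ++-identityʳ; concatMap-++)
open import Data.List.Relation.Unary.Linked as Linked using (Linked; []; [-]; _∷_)
open import Data.List.Relation.Binary.Infix.Heterogeneous using (Infix; MkView; toView)
open import Data.List.Relation.Binary.Infix.Heterogeneous.Properties using (infix?)
open import Data.List.Relation.Binary.Pointwise using (Pointwise-≡⇒≡)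
open import Data.Bool using (Bool; true; false; T)
open import Data.Unit using (⊤; tt)
open import Data.Product using (_×_; _,_; ∃; ∃₂; proj₁; proj₂)
open import Relation.Nullary.Decidable using (from-yes; T?; _→-dec_; yes; no)
open import Relation.Binary.PropositionalEquality
open import Function using (_∘_)

_≼_ : ∀ {A : Set} → List A → List A → Set
u ≼ w = ∃ λ v → w ≡ u ++ v

≼-refl : ∀ {A : Set} (w : List A) → w ≼ w
≼-refl w = [] , sym (++-identityʳ w)

≼-trans : ∀ {A : Set} {u v w : List A} → u ≼ v → v ≼ w → u ≼ w
≼-trans {u = u} (a , v≡) (b , w≡) = a ++ b , trans w≡ (trans (cong (_++ b) v≡) (++-assoc u a b))

concatMap-≼ : ∀ {A B : Set} (h : A → List B) {u w : List A} → u ≼ w → concatMap h u ≼ concatMap h w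
concatMap-≼ h {u} (v , w≡) = concatMap h v , trans (cong (concatMap h) w≡) (concatMap-++ h u v)

concatMap-commute : ∀ {A B C D : Set}
  (h₁ : B → List D) (h₂ : A → List B) (h₃ : C → List D) (h₄ : A → List C) →
  (∀ a → concatMap h₁ (h₂ a) ≡ concatMap h₃ (h₄ a)) →
  ∀ w → concatMap h₁ (concatMap h₂ w) ≡ concatMap h₃ (concatMap h₄ w)
concatMap-commute h₁ h₂ h₃ h₄ eq [] = refl
concatMap-commute h₁ h₂ h₃ h₄ eq (a ∷ w) = begin
  concatMap h₁ (h₂ a ++ concatMap h₂ w)               ≡⟨ concatMap-++ h₁ (h₂ a) _ ⟩
  concatMap h₁ (h₂ a) ++ concatMap h₁ (concatMap h₂ w) ≡⟨ cong₂ _++_ (eq a) (concatMap-commute h₁ h₂ h₃ h₄ eq w) ⟩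
  concatMap h₃ (h₄ a) ++ concatMap h₃ (concatMap h₄ w) ≡⟨ concatMap-++ h₃ (h₄ a) _ ⟨
  concatMap h₃ (h₄ a ++ concatMap h₄ w)               ∎
  where open ≡-Reasoning

NonErasing : ∀ {A B : Set} → (A → List B) → Set
NonErasing h = ∀ a → 1 ≤ length (h a)

Expanding : ∀ {A : Set} → (A → List A) → Set
Expanding h = ∀ a → 2 ≤ length (h a)

expanding⇒nonErasing : ∀ {A : Set} {h : A → List A} → Expanding h → NonErasing h
expanding⇒nonErasing exp a = ≤-trans (s≤s z≤n) (exp a)

length≤length-concatMap : ∀ {A B : Set} {h : A → List B} → NonErasing h →
  ∀ w → length w ≤ length (concatMap h w)
length≤length-concatMap ne [] = z≤n
length≤length-concatMap {h = h} ne (a ∷ w) =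
  subst (suc (length w) ≤_) (sym (length-++ (h a))) (+-mono-≤ (ne a) (length≤length-concatMap ne w))

2*length≤length-concatMap : ∀ {A : Set} {h : A → List A} → Expanding h →
  ∀ w → length w + length w ≤ length (concatMap h w)
2*length≤length-concatMap exp [] = z≤n
2*length≤length-concatMap {h = h} exp (a ∷ w) =
  subst₂ _≤_ (cong suc (sym (+-suc (length w) (length w)))) (sym (length-++ (h a)))
    (+-mono-≤ (exp a) (2*length≤length-concatMap exp w))

1≤length⇒∷ : ∀ {A : Set} {w : List A} → 1 ≤ length w → ∃₂ λ a v → w ≡ a ∷ v
1≤length⇒∷ {w = a ∷ v} _ = a , v , refl

Linked-middle : ∀ {A : Set} {R : A → A → Set} pre {a b} rest → Linked R (pre ++ a ∷ b ∷ rest) → R a b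
Linked-middle []        rest l = Linked.head l
Linked-middle (_ ∷ pre) rest l = Linked-middle pre rest (Linked.tail l)

infix⇒++ : ∀ {A : Set} {u w : List A} → Infix _≡_ u w → ∃₂ λ α β → w ≡ α ++ u ++ β
infix⇒++ p with toView p
... | MkView α eq β = α , β , cong (λ v → α ++ v ++ β) (sym (Pointwise-≡⇒≡ eq))

Fin-bounded : ∀ {k} (h : Fin k → ℕ) → ∃ λ B → ∀ a → h a ≤ B
Fin-bounded {zero}  h = 0 , λ ()
Fin-bounded {suc k} h with Fin-bounded (h ∘ suc)
... | B , bounded = h zero ⊔ B , λ where
  zero    → m≤m⊔n (h zero) B
  (suc a) → ≤-trans (bounded a) (m≤n⊔m (h zero) B)

lookupD-++ˡ : ∀ {A : Set} (d : A) (u v : List A) {i} → i < length u → lookupD d (u ++ v) i ≡ lookupD d u i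
lookupD-++ˡ d (a ∷ u) v {zero}  _         = refl
lookupD-++ˡ d (a ∷ u) v {suc i} (s≤s i<u) = lookupD-++ˡ d u v i<u

lookupD-++ʳ : ∀ {A : Set} (d : A) (u v : List A) i → lookupD d (u ++ v) (length u + i) ≡ lookupD d v i
lookupD-++ʳ d []      v i = refl
lookupD-++ʳ d (a ∷ u) v i = lookupD-++ʳ d u v i

lookupD-≼ : ∀ {A : Set} (d : A) {u w : List A} {i} → u ≼ w → i < length u → lookupD d w i ≡ lookupD d u i
lookupD-≼ d {u} (v , refl) = lookupD-++ˡ d u v

length-prefix : ∀ {A : Set} (s : Seq A) n → length (prefix s n) ≡ n
length-prefix s zero    = refl
length-prefix s (suc n) = cong suc (length-prefix (s ∘ suc) n)

prefix-suc : ∀ {A : Set} (s : Seq A) n → prefix s (suc n) ≡ prefix s n ++ s n ∷ []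
prefix-suc s zero    = refl
prefix-suc s (suc n) = cong (s zero ∷_) (prefix-suc (s ∘ suc) n)

prefix-≼ : ∀ {A : Set} (d : A) (s : Seq A) n (w : List A) → n ≤ length w →
  (∀ i → i < n → s i ≡ lookupD d w i) → prefix s n ≼ w
prefix-≼ d s zero    w       _         _     = w , refl
prefix-≼ d s (suc n) (a ∷ w) (s≤s n≤w) agree
  with v , w≡ ← prefix-≼ d (s ∘ suc) n w n≤w (λ i i<n → agree (suc i) (s≤s i<n))
  = v , cong₂ _∷_ (sym (agree zero (s≤s z≤n))) w≡

UniformlyRecurrent-cong : ∀ {A : Set} {s s′ : Seq A} → (∀ i → s i ≡ s′ i) →
  UniformlyRecurrent s′ → UniformlyRecurrent s
UniformlyRecurrent-cong {s = s} {s′} s≡s′ rec n with N , occurs ← rec n = N , λ i j →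
  let k , k≤ , agree = occurs i j
  in k , k≤ , λ t t<n → trans (s≡s′ (j + t)) (trans (agree t t<n) (sym (s≡s′ (i + k + t))))

applyS-≼ : ∀ {k m} {h : Morphism k m} → NonErasing h → ∀ d s i {w} →
  prefix s (suc i) ≼ w → applyS h d s i ≡ lookupD d (applyW h w) i
applyS-≼ {h = h} ne d s i p = sym (lookupD-≼ d (concatMap-≼ h p)
  (≤-trans (≤-reflexive (sym (length-prefix s (suc i)))) (length≤length-concatMap {h = h} ne (prefix s (suc i)))))

iterW-++ : ∀ {k} (h : Morphism k k) n (u w : List (Fin k)) → iterW h n (u ++ w) ≡ iterW h n u ++ iterW h n w
iterW-++ h zero    u w = refl
iterW-++ h (suc n) u w = trans (cong (applyW h) (iterW-++ h n u w)) (concatMap-++ h (iterW h n u) (iterW h n w))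

iterW-+ : ∀ {k} (h : Morphism k k) m n (w : List (Fin k)) → iterW h (m + n) w ≡ iterW h m (iterW h n w)
iterW-+ h zero    n w = refl
iterW-+ h (suc m) n w = cong (applyW h) (iterW-+ h m n w)

iterW-[] : ∀ {k} (h : Morphism k k) n → iterW h n [] ≡ []
iterW-[] h zero    = refl
iterW-[] h (suc n) = cong (applyW h) (iterW-[] h n)

length-iterW : ∀ {k} {h : Morphism k k} → Expanding h → ∀ n a → suc n ≤ length (iterW h n (a ∷ []))
length-iterW exp zero    a = s≤s z≤n
length-iterW {h = h} exp (suc n) a = ≤-trans (s≤s (m≤n+m (suc n) n))
  (≤-trans (+-mono-≤ (length-iterW {h = h} exp n a) (length-iterW {h = h} exp n a))
            (2*length≤length-concatMap {h = h} exp (iterW h n (a ∷ []))))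

module FixedPoint {k} (h : Morphism k k) (h-expanding : Expanding h)
                  (j b : Fin k) (v : List (Fin k)) (hj : h j ≡ j ∷ b ∷ v) where

  P : ℕ → List (Fin k)
  P n = iterW h n (j ∷ [])

  P-extends : ∀ n → ∃₂ λ a w → P (suc n) ≡ P n ++ a ∷ w
  P-extends zero = b , v , trans (++-identityʳ (h j)) hj
  P-extends (suc n)
    with a , w , P≡ ← P-extends n
    with a′ , w′ , ha≡ ← 1≤length⇒∷ (expanding⇒nonErasing {h = h} h-expanding a)
    = a′ , w′ ++ applyW h w , (begin
      applyW h (P (suc n))          ≡⟨ cong (applyW h) P≡ ⟩
      applyW h (P n ++ a ∷ w)        ≡⟨ concatMap-++ h (P n) (a ∷ w) ⟩
      P (suc n) ++ h a ++ applyW h w ≡⟨ cong (λ ha → P (suc n) ++ ha ++ applyW h w) ha≡ ⟩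
      P (suc n) ++ a′ ∷ w′ ++ applyW h w ∎)
    where open ≡-Reasoning

  next-letter : ∀ n pre a suf → P n ≡ pre ++ a ∷ suf → ∃₂ λ b rest → P (suc n) ≡ pre ++ a ∷ b ∷ rest
  next-letter n pre a suf P≡ with a′ , w , P′≡ ← P-extends n with suf
  ... | []        = a′ , w , trans P′≡ (trans (cong (_++ a′ ∷ w) P≡) (++-assoc pre (a ∷ []) (a′ ∷ w)))
  ... | b ∷ suf′ = b , suf′ ++ a′ ∷ w , trans P′≡ (trans (cong (_++ a′ ∷ w) P≡) (++-assoc pre (a ∷ b ∷ suf′) (a′ ∷ w)))

  P-≼ : ∀ {m n} → m ≤ n → P m ≼ P n
  P-≼ {m} {n} m≤n = subst (λ n → P m ≼ P n) (m+[n∸m]≡n m≤n) (go (n ∸ m))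
    where
    go : ∀ i → P m ≼ P (m + i)
    go zero    = subst (λ n → P m ≼ P n) (sym (+-identityʳ m)) (≼-refl (P m))
    go (suc i) with a , w , P≡ ← P-extends (m + i) =
      subst (λ n → P m ≼ P n) (sym (+-suc m i)) (≼-trans (go i) (a ∷ w , P≡))

  length-P : ∀ n → suc n ≤ length (P n)
  length-P n = length-iterW h-expanding n j

  fixPt-P : ∀ {i n} → i < n → fixPt h j i ≡ lookupD j (P n) i
  fixPt-P {i} i<n = sym (lookupD-≼ j (P-≼ i<n) (≤-trans (n≤1+n (suc i)) (length-P (suc i))))

  prefix-fixPt-≼ : ∀ n → prefix (fixPt h j) n ≼ P n
  prefix-fixPt-≼ n = prefix-≼ j (fixPt h j) n (P n) (≤-trans (n≤1+n n) (length-P n)) (λ i → fixPt-P)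

  applyS-fixPt : ∀ {m} {ξ : Morphism k m} → NonErasing ξ → ∀ d {i n} → i < n →
    applyS ξ d (fixPt h j) i ≡ lookupD d (applyW ξ (P n)) i
  applyS-fixPt ne d {i} i<n = applyS-≼ ne d (fixPt h j) i (≼-trans (prefix-fixPt-≼ (suc i)) (P-≼ i<n))

record Block {A B : Set} (h : A → List B) (w : List A) (p : ℕ) : Set where
  constructor block
  field
    pre suf : List A
    letter  : A
    offset  : ℕ
    split   : w ≡ pre ++ letter ∷ suf
    p≡      : p ≡ length (concatMap h pre) + offset
    offset< : offset < length (h letter)

decompose : ∀ {A B : Set} (h : A → List B) w p → p < length (concatMap h w) → Block h w p
decompose h (a ∷ w) p p< with p <? length (h a)
... | yes p<ha = block [] w a p refl refl p<ha
... | no  p≮ha = extend (decompose h w (p ∸ length (h a)) p∸<)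
  where
  ha≤p : length (h a) ≤ p
  ha≤p = ≮⇒≥ p≮ha
  p∸< : p ∸ length (h a) < length (concatMap h w)
  p∸< = subst (p ∸ length (h a) <_) (m+n∸m≡n (length (h a)) (length (concatMap h w)))
          (∸-monoˡ-< (subst (p <_) (length-++ (h a)) p<) ha≤p)
  extend : Block h w (p ∸ length (h a)) → Block h (a ∷ w) p
  extend (block pre suf letter offset split p∸≡ offset<) =
    block (a ∷ pre) suf letter offset (cong (a ∷_) split) p≡ offset<
    where
    open ≡-Reasoning
    p≡ : p ≡ length (h a ++ concatMap h pre) + offset
    p≡ = begin
      p                                                  ≡⟨ m+[n∸m]≡n ha≤p ⟨
      length (h a) + (p ∸ length (h a))                  ≡⟨ cong (length (h a) +_) p∸≡ ⟩
      length (h a) + (length (concatMap h pre) + offset) ≡⟨ +-assoc (length (h a)) _ offset ⟨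
      length (h a) + length (concatMap h pre) + offset   ≡⟨ cong (_+ offset) (length-++ (h a)) ⟨
      length (h a ++ concatMap h pre) + offset           ∎

OccursInEveryImage : ∀ {k} → Morphism k k → ℕ → Fin k → Fin k → Set
OccursInEveryImage h K a b = ∀ c → Infix _≡_ (a ∷ b ∷ []) (iterW h K (c ∷ []))

module Recurrence {k m} (φ : Morphism k k) (φ-expanding : Expanding φ)
                  (j b : Fin k) (v : List (Fin k)) (φj : φ j ≡ j ∷ b ∷ v)
                  (ξ : Morphism k m) (ξ-nonErasing : NonErasing ξ) (d : Fin m) (K : ℕ)
                  (pairs-recur : ∀ n → Linked (OccursInEveryImage φ K) (iterW φ n (j ∷ [])))
                  where
  open FixedPoint φ φ-expanding j b v φj

  s : Seq (Fin m)
  s = applyS ξ d (fixPt φ j)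

  Θ : ℕ → List (Fin k) → List (Fin m)
  Θ M w = applyW ξ (iterW φ M w)

  θ : ℕ → Fin k → List (Fin m)
  θ M a = Θ M (a ∷ [])

  Θ-++ : ∀ M u w → Θ M (u ++ w) ≡ Θ M u ++ Θ M w
  Θ-++ M u w = trans (cong (applyW ξ) (iterW-++ φ M u w)) (concatMap-++ ξ (iterW φ M u) (iterW φ M w))

  Θ-+ : ∀ M N w → Θ (M + N) w ≡ Θ M (iterW φ N w)
  Θ-+ M N w = cong (applyW ξ) (iterW-+ φ M N w)

  Θ-concatMap : ∀ M w → Θ M w ≡ concatMap (θ M) w
  Θ-concatMap M []      = cong (applyW ξ) (iterW-[] φ M)
  Θ-concatMap M (a ∷ w) = trans (Θ-++ M (a ∷ []) w) (cong (θ M a ++_) (Θ-concatMap M w))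

  length-θ : ∀ M a → suc M ≤ length (θ M a)
  length-θ M a = ≤-trans (length-iterW φ-expanding M a) (length≤length-concatMap ξ-nonErasing (iterW φ M (a ∷ [])))

  length-Θ-pair : ∀ M a a′ → length (Θ M (a ∷ a′ ∷ [])) ≡ length (θ M a) + length (θ M a′)
  length-Θ-pair M a a′ = trans (cong length (Θ-++ M (a ∷ []) (a′ ∷ []))) (length-++ (θ M a))

  _occursAt_ : List (Fin m) → ℕ → Set
  V occursAt q = ∀ t → t < length V → s (q + t) ≡ lookupD d V t

  occursAt-++ˡ : ∀ V W {q} → (V ++ W) occursAt q → V occursAt q
  occursAt-++ˡ V W occ t t<V =
    trans (occ t (≤-trans t<V (length-++-≤ˡ V))) (lookupD-++ˡ d V W t<V)

  occursAt-++ʳ : ∀ V W {q} → (V ++ W) occursAt q → W occursAt (q + length V)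
  occursAt-++ʳ V W {q} occ t t<W = begin
    s (q + length V + t)          ≡⟨ cong s (+-assoc q (length V) t) ⟩
    s (q + (length V + t))        ≡⟨ occ (length V + t) (subst (length V + t <_) (sym (length-++ V)) (+-monoʳ-< (length V) t<W)) ⟩
    lookupD d (V ++ W) (length V + t) ≡⟨ lookupD-++ʳ d V W t ⟩
    lookupD d W t                 ∎
    where open ≡-Reasoning

  Θ-infix-occursAt : ∀ {M q} α mid β → Θ M (α ++ mid ++ β) occursAt q → Θ M mid occursAt (q + length (Θ M α))
  Θ-infix-occursAt {M} α mid β occ = occursAt-++ˡ (Θ M mid) (Θ M β) (occursAt-++ʳ (Θ M α) (Θ M mid ++ Θ M β)
    (subst (_occursAt _) (trans (Θ-++ M α (mid ++ β)) (cong (Θ M α ++_) (Θ-++ M mid β))) occ))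

  Θ-P-occursAt-0 : ∀ M n → Θ M (P n) occursAt 0
  Θ-P-occursAt-0 M n = subst (_occursAt 0) (Θ-+ M n (j ∷ [])) λ t t<ξP →
    trans (applyS-fixPt ξ-nonErasing d (m≤m+n (suc t) (M + n)))
          (lookupD-≼ d (concatMap-≼ ξ (P-≼ (m≤n+m (M + n) (suc t)))) t<ξP)

  -- s is the concatenation of the blocks θ M c over the letters c of φ^ω(j); letter p of s lies
  -- at the given offset in the block θ M a, which is followed by the block θ M a′.
  record Position (M p : ℕ) : Set where
    field
      pre rest : List (Fin k)
      a a′     : Fin k
      offset   : ℕ
      P-split  : P (suc p) ≡ pre ++ a ∷ a′ ∷ rest
      p≡       : p ≡ length (Θ M pre) + offset
      offset<  : offset < length (θ M a)

  p<length-θ-P : ∀ M p → p < length (concatMap (θ M) (P p))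
  p<length-θ-P M p = ≤-trans (length-P p) (length≤length-concatMap (λ a → ≤-trans (s≤s z≤n) (length-θ M a)) (P p))

  position : ∀ M p → Position M p
  position M p with block pre suf a offset P≡ p≡ offset< ← decompose (θ M) (P p) p (p<length-θ-P M p)
    with a′ , rest , P′≡ ← next-letter p pre a suf P≡ = record
    { pre = pre ; rest = rest ; a = a ; a′ = a′ ; offset = offset ; P-split = P′≡
    ; p≡ = trans p≡ (cong (λ w → length w + offset) (sym (Θ-concatMap M pre))) ; offset< = offset< }

  pair-occursAt-position : ∀ {M p} (B : Position M p) →
    let open Position B in Θ M (a ∷ a′ ∷ []) occursAt length (Θ M pre)
  pair-occursAt-position {M} {p} B = Θ-infix-occursAt {M} pre (a ∷ a′ ∷ []) rest
    (subst (λ w → Θ M w occursAt 0) P-split (Θ-P-occursAt-0 M (suc p)))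
    where open Position B

  factor-within-pair : ∀ n p → ∃₂ λ b b′ → ∃ λ offset →
    OccursInEveryImage φ K b b′ × offset + n ≤ length (Θ n (b ∷ b′ ∷ [])) ×
    (∀ t → t < n → s (p + t) ≡ lookupD d (Θ n (b ∷ b′ ∷ [])) (offset + t))
  factor-within-pair n p = a , a′ , offset , recur , fits , factor
    where
    C = position n p
    open Position C
    recur : OccursInEveryImage φ K a a′
    recur = Linked-middle pre rest (subst (Linked _) P-split (pairs-recur (suc p)))
    fits : offset + n ≤ length (Θ n (a ∷ a′ ∷ []))
    fits = subst (offset + n ≤_) (sym (length-Θ-pair n a a′))
             (+-mono-≤ (<⇒≤ offset<) (≤-trans (n≤1+n n) (length-θ n a′)))
    factor : ∀ t → t < n → s (p + t) ≡ lookupD d (Θ n (a ∷ a′ ∷ [])) (offset + t)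
    factor t t<n = trans (cong s (trans (cong (_+ t) p≡) (+-assoc (length (Θ n pre)) offset t)))
      (pair-occursAt-position C (offset + t) (<-≤-trans (+-monoʳ-< offset t<n) fits))

  pair-occurs-near : ∀ n {i} (C : Position (n + K) i) {b b′} → OccursInEveryImage φ K b b′ →
    let open Position C in
    ∃ λ shift → shift + length (Θ n (b ∷ b′ ∷ [])) ≤ length (θ (n + K) a) + length (θ (n + K) a′) ×
            Θ n (b ∷ b′ ∷ []) occursAt (i + shift)
  pair-occurs-near n {i} C {b} {b′} recur with α , β , iter≡ ← infix⇒++ (recur (Position.a′ C)) =
    shift , shift≤ , subst (Θ n W occursAt_) i+shift≡ occ
    where
    open Position C
    M = n + K
    W = b ∷ b′ ∷ []
    a′≡ : θ M a′ ≡ Θ n (α ++ W ++ β)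
    a′≡ = trans (Θ-+ n K (a′ ∷ [])) (cong (Θ n) iter≡)
    occ : Θ n W occursAt (length (Θ M pre) + length (θ M a) + length (Θ n α))
    occ = Θ-infix-occursAt {n} α W β (subst (_occursAt (length (Θ M pre) + length (θ M a))) a′≡
            (Θ-infix-occursAt {M} (a ∷ []) (a′ ∷ []) [] (pair-occursAt-position C)))
    shift = (length (θ M a) ∸ offset) + length (Θ n α)
    i+shift≡ : length (Θ M pre) + length (θ M a) + length (Θ n α) ≡ i + shift
    i+shift≡ = sym (begin
      i + shift                                            ≡⟨ cong (_+ shift) p≡ ⟩
      length (Θ M pre) + offset + (θa∸offset + length (Θ n α))
        ≡⟨ solve 4 (λ l o e x → l :+ o :+ (e :+ x) := l :+ (o :+ e) :+ x) refl
                   (length (Θ M pre)) offset θa∸offset (length (Θ n α)) ⟩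
      length (Θ M pre) + (offset + θa∸offset) + length (Θ n α)
        ≡⟨ cong (λ l → length (Θ M pre) + l + length (Θ n α)) (m+[n∸m]≡n (<⇒≤ offset<)) ⟩
      length (Θ M pre) + length (θ M a) + length (Θ n α)   ∎)
      where
      open ≡-Reasoning
      θa∸offset = length (θ M a) ∸ offset
    αW≤a′ : length (Θ n α) + length (Θ n W) ≤ length (θ M a′)
    αW≤a′ = subst (length (Θ n α) + length (Θ n W) ≤_)
      (sym (trans (cong length (trans a′≡ (trans (Θ-++ n α (W ++ β)) (cong (Θ n α ++_) (Θ-++ n W β)))))
           (trans (length-++ (Θ n α)) (cong (length (Θ n α) +_) (length-++ (Θ n W))))))
      (+-monoʳ-≤ (length (Θ n α)) (m≤m+n (length (Θ n W)) (length (Θ n β))))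
    shift≤ : shift + length (Θ n W) ≤ length (θ M a) + length (θ M a′)
    shift≤ = subst (_≤ length (θ M a) + length (θ M a′)) (sym (+-assoc (length (θ M a) ∸ offset) _ _))
           (+-mono-≤ (m∸n≤m (length (θ M a)) offset) αW≤a′)

  pair-occurs-within : ∀ n {B} → (∀ c → length (θ (n + K) c) ≤ B) → ∀ i {b b′} → OccursInEveryImage φ K b b′ →
    ∃ λ shift → shift + length (Θ n (b ∷ b′ ∷ [])) ≤ B + B × Θ n (b ∷ b′ ∷ []) occursAt (i + shift)
  pair-occurs-within n bounded i recur =
    let C = position (n + K) i
        shift , shift≤ , occ = pair-occurs-near n C recur
    in shift , ≤-trans shift≤ (+-mono-≤ (bounded (Position.a C)) (bounded (Position.a′ C))) , occ

  uniformlyRecurrent : UniformlyRecurrent s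
  uniformlyRecurrent n = B + B , recurrence
    where
    B = proj₁ (Fin-bounded (λ c → length (θ (n + K) c)))
    bounded = proj₂ (Fin-bounded (λ c → length (θ (n + K) c)))
    recurrence : ∀ i p → ∃ λ shift → shift + n ≤ B + B × (∀ t → t < n → s (p + t) ≡ s (i + shift + t))
    recurrence i p =
      let b , b′ , offset , recur , fits , factor = factor-within-pair n p
          shift , shift≤ , occ = pair-occurs-within n bounded i recur
      in shift + offset
       , subst (_≤ B + B) (sym (+-assoc shift offset n)) (≤-trans (+-monoʳ-≤ shift fits) shift≤)
       , λ t t<n → trans (factor t t<n) (sym (trans
           (cong s (trans (cong (_+ t) (sym (+-assoc i shift offset))) (+-assoc (i + shift) offset t)))
           (occ (offset + t) (<-≤-trans (+-monoʳ-< offset t<n) fits))))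

φ-expanding : Expanding φ
φ-expanding = from-yes (all? λ a → 2 ≤? length (φ a))

f-expanding : Expanding f
f-expanding = from-yes (all? λ a → 2 ≤? length (f a))

g-nonErasing : NonErasing g
g-nonErasing = from-yes (all? λ a → 1 ≤? length (g a))

ξ-nonErasing : NonErasing ξ
ξ-nonErasing = from-yes (all? λ a → 1 ≤? length (ξ a))

admissible : Fin 5 → Fin 5 → Bool
admissible zero    zero    = false
admissible zero    (suc _) = true
admissible (suc _) zero    = true
admissible (suc (suc (suc (suc zero)))) (suc (suc (suc (suc zero)))) = true
admissible _       _       = false

Admissible : Fin 5 → Fin 5 → Set
Admissible a b = T (admissible a b)

StartsWith0 : List (Fin 5) → Set
StartsWith0 []      = ⊤
StartsWith0 (a ∷ _) = a ≡ d0

φ-++-admissible : ∀ a {w} → Linked Admissible w → StartsWith0 w → Linked Admissible (φ a ++ w)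
φ-++-admissible zero                         {[]}    _ _    = tt ∷ [-]
φ-++-admissible zero                         {_ ∷ _} l refl = tt ∷ tt ∷ l
φ-++-admissible (suc zero)                   {[]}    _ _    = tt ∷ [-]
φ-++-admissible (suc zero)                   {_ ∷ _} l refl = tt ∷ tt ∷ l
φ-++-admissible (suc (suc zero))             {[]}    _ _    = tt ∷ [-]
φ-++-admissible (suc (suc zero))             {_ ∷ _} l refl = tt ∷ tt ∷ l
φ-++-admissible (suc (suc (suc zero)))       {[]}    _ _    = tt ∷ [-]
φ-++-admissible (suc (suc (suc zero)))       {_ ∷ _} l refl = tt ∷ tt ∷ l
φ-++-admissible (suc (suc (suc (suc zero)))) {[]}    _ _    = tt ∷ tt ∷ [-]
φ-++-admissible (suc (suc (suc (suc zero)))) {_ ∷ _} l refl = tt ∷ tt ∷ tt ∷ l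

φ-image-startsWith0 : ∀ w → StartsWith0 (applyW φ w)
φ-image-startsWith0 []                                 = tt
φ-image-startsWith0 (zero ∷ _)                         = refl
φ-image-startsWith0 (suc zero ∷ _)                     = refl
φ-image-startsWith0 (suc (suc zero) ∷ _)               = refl
φ-image-startsWith0 (suc (suc (suc zero)) ∷ _)         = refl
φ-image-startsWith0 (suc (suc (suc (suc zero))) ∷ _)   = refl

φ-image-admissible : ∀ w → Linked Admissible (applyW φ w)
φ-image-admissible []      = []
φ-image-admissible (a ∷ w) = φ-++-admissible a (φ-image-admissible w) (φ-image-startsWith0 w)

admissible-occurs : ∀ a b → Admissible a b → OccursInEveryImage φ 5 a b
admissible-occurs = from-yes (all? λ a → all? λ b → T? (admissible a b) →-dec
  all? λ c → infix? _≟ᶠ_ (a ∷ b ∷ []) (iterW φ 5 (c ∷ [])))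

φ-pairs-recur : ∀ n → Linked (OccursInEveryImage φ 5) (iterW φ n (d0 ∷ []))
φ-pairs-recur zero    = [-]
φ-pairs-recur (suc n) = Linked.map (admissible-occurs _ _) (φ-image-admissible (iterW φ n (d0 ∷ [])))

ξφ^ω-uniformlyRecurrent : UniformlyRecurrent (applyS ξ c0 (fixPt φ d0))
ξφ^ω-uniformlyRecurrent = Recurrence.uniformlyRecurrent φ φ-expanding d0 d1 [] refl ξ ξ-nonErasing c0 5 φ-pairs-recur

τ′ : Parity → Fin 3 → List (Fin 3)
τ′ 0ℙ zero             = wB
τ′ 0ℙ (suc zero)       = wA
τ′ 0ℙ (suc (suc zero)) = wA ++ wA
τ′ 1ℙ zero             = wD
τ′ 1ℙ (suc zero)       = wC
τ′ 1ℙ (suc (suc zero)) = wC ++ wC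

τ≡τ′ : ∀ i a → τ i a ≡ τ′ (parity i) a
τ≡τ′ zero             zero             = refl
τ≡τ′ zero             (suc zero)       = refl
τ≡τ′ zero             (suc (suc zero)) = refl
τ≡τ′ (suc zero)       zero             = refl
τ≡τ′ (suc zero)       (suc zero)       = refl
τ≡τ′ (suc zero)       (suc (suc zero)) = refl
τ≡τ′ (suc (suc i))    a                = τ≡τ′ i a

τ-nonErasing : ∀ i → NonErasing (τ i)
τ-nonErasing i a = subst (λ w → 1 ≤ length w) (sym (τ≡τ′ i a)) (τ′-nonErasing (parity i) a)
  where
  τ′-nonErasing : ∀ e → NonErasing (τ′ e)
  τ′-nonErasing 0ℙ = from-yes (all? λ a → 1 ≤? length (τ′ 0ℙ a))
  τ′-nonErasing 1ℙ = from-yes (all? λ a → 1 ≤? length (τ′ 1ℙ a))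

-- τ applied letter by letter to a word whose first letter sits at position p of y
τFrom : ℕ → List (Fin 3) → List (Fin 3)
τFrom p []      = []
τFrom p (a ∷ w) = τ p a ++ τFrom (suc p) w

τFrom-++ : ∀ p u w → τFrom p (u ++ w) ≡ τFrom p u ++ τFrom (p + length u) w
τFrom-++ p []      w = cong (λ q → τFrom q w) (sym (+-identityʳ p))
τFrom-++ p (a ∷ u) w = begin
  τ p a ++ τFrom (suc p) (u ++ w)                                ≡⟨ cong (τ p a ++_) (τFrom-++ (suc p) u w) ⟩
  τ p a ++ (τFrom (suc p) u ++ τFrom (suc p + length u) w)      ≡⟨ cong (λ q → τ p a ++ (τFrom (suc p) u ++ τFrom q w)) (sym (+-suc p (length u))) ⟩
  τ p a ++ (τFrom (suc p) u ++ τFrom (p + suc (length u)) w)    ≡⟨ ++-assoc (τ p a) (τFrom (suc p) u) _ ⟨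
  (τ p a ++ τFrom (suc p) u) ++ τFrom (p + suc (length u)) w    ∎
  where open ≡-Reasoning

length-τFrom : ∀ p w → length w ≤ length (τFrom p w)
length-τFrom p []      = z≤n
length-τFrom p (a ∷ w) = subst (suc (length w) ≤_) (sym (length-++ (τ p a)))
  (+-mono-≤ (τ-nonErasing p a) (length-τFrom (suc p) w))

τFrom-≼ : ∀ p {u w} → u ≼ w → τFrom p u ≼ τFrom p w
τFrom-≼ p {u} (v , refl) = τFrom (p + length u) v , τFrom-++ p u v

τPrefix≡τFrom : ∀ n → τPrefix n ≡ τFrom 0 (prefix y n)
τPrefix≡τFrom zero    = refl
τPrefix≡τFrom (suc n) = sym (begin
  τFrom 0 (prefix y (suc n))                                 ≡⟨ cong (τFrom 0) (prefix-suc y n) ⟩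
  τFrom 0 (prefix y n ++ y n ∷ [])                           ≡⟨ τFrom-++ 0 (prefix y n) (y n ∷ []) ⟩
  τFrom 0 (prefix y n) ++ τ (length (prefix y n)) (y n) ++ [] ≡⟨ cong₂ _++_ (sym (τPrefix≡τFrom n))
                                                                   (trans (++-identityʳ _) (cong (λ q → τ q (y n)) (length-prefix y n))) ⟩
  τPrefix n ++ τ n (y n)                                     ∎)
  where open ≡-Reasoning

τFromᴾ : Parity → List (Fin 3) → List (Fin 3)
τFromᴾ e []      = []
τFromᴾ e (a ∷ w) = τ′ e a ++ τFromᴾ (e ⁻¹ℙ) w

τFrom≡τFromᴾ : ∀ p w → τFrom p w ≡ τFromᴾ (parity p) w
τFrom≡τFromᴾ p []      = refl
τFrom≡τFromᴾ p (a ∷ w) = cong₂ _++_ (τ≡τ′ p a)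
  (trans (τFrom≡τFromᴾ (suc p) w) (cong (λ e → τFromᴾ e w) (sym (⁻¹-selfInverse (suc-homo-⁻¹ p)))))

-- (e , a): the g-image of the letter a begins at a position of y of parity e
annotate : Parity → List (Fin 3) → List (Parity × Fin 3)
annotate e []      = []
annotate e (a ∷ w) = (e , a) ∷ annotate (e +ℙ parity (length (g a))) w

f̂ : Parity × Fin 3 → List (Parity × Fin 3)
f̂ (e , a) = annotate e (f a)

τĝ : Parity × Fin 3 → List (Fin 3)
τĝ (e , a) = τFromᴾ e (g a)

σ : Fin 5 → List (Parity × Fin 3)
σ zero                         = (0ℙ , c0) ∷ []
σ (suc zero)                   = (0ℙ , c1) ∷ []
σ (suc (suc zero))             = (0ℙ , c2) ∷ (1ℙ , c2) ∷ []
σ (suc (suc (suc zero)))       = (0ℙ , c2) ∷ (1ℙ , c0) ∷ (1ℙ , c2) ∷ []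
σ (suc (suc (suc (suc zero)))) = (0ℙ , c2) ∷ (1ℙ , c0) ∷ (1ℙ , c1) ∷ (1ℙ , c0) ∷ (1ℙ , c2) ∷ []

annotate-f-++ : ∀ e a w → annotate e (f a ++ w) ≡ f̂ (e , a) ++ annotate (e +ℙ parity (length (g a))) w
annotate-f-++ 0ℙ zero             w = refl
annotate-f-++ 0ℙ (suc zero)       w = refl
annotate-f-++ 0ℙ (suc (suc zero)) w = refl
annotate-f-++ 1ℙ zero             w = refl
annotate-f-++ 1ℙ (suc zero)       w = refl
annotate-f-++ 1ℙ (suc (suc zero)) w = refl

annotate-f : ∀ e w → annotate e (applyW f w) ≡ concatMap f̂ (annotate e w)
annotate-f e []      = refl
annotate-f e (a ∷ w) = trans (annotate-f-++ e a (applyW f w)) (cong (f̂ (e , a) ++_) (annotate-f _ w))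

τFromᴾ-g-++ : ∀ e a w → τFromᴾ e (g a ++ w) ≡ τĝ (e , a) ++ τFromᴾ (e +ℙ parity (length (g a))) w
τFromᴾ-g-++ 0ℙ zero             w = refl
τFromᴾ-g-++ 0ℙ (suc zero)       w = refl
τFromᴾ-g-++ 0ℙ (suc (suc zero)) w = refl
τFromᴾ-g-++ 1ℙ zero             w = refl
τFromᴾ-g-++ 1ℙ (suc zero)       w = refl
τFromᴾ-g-++ 1ℙ (suc (suc zero)) w = refl

τFromᴾ-g : ∀ e w → τFromᴾ e (applyW g w) ≡ concatMap τĝ (annotate e w)
τFromᴾ-g e []      = refl
τFromᴾ-g e (a ∷ w) = trans (τFromᴾ-g-++ e a (applyW g w)) (cong (τĝ (e , a) ++_) (τFromᴾ-g _ w))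

σ-φ : ∀ a → concatMap σ (φ a) ≡ concatMap f̂ (σ a)
σ-φ zero                         = refl
σ-φ (suc zero)                   = refl
σ-φ (suc (suc zero))             = refl
σ-φ (suc (suc (suc zero)))       = refl
σ-φ (suc (suc (suc (suc zero)))) = refl

τĝ-σ : ∀ a → concatMap τĝ (σ a) ≡ applyW ξ (φ a)
τĝ-σ zero                         = refl
τĝ-σ (suc zero)                   = refl
τĝ-σ (suc (suc zero))             = refl
τĝ-σ (suc (suc (suc zero)))       = refl
τĝ-σ (suc (suc (suc (suc zero)))) = refl

annotate-fⁿ : ∀ n → annotate 0ℙ (iterW f n (c0 ∷ [])) ≡ concatMap σ (iterW φ n (d0 ∷ []))
annotate-fⁿ zero    = refl
annotate-fⁿ (suc n) = begin
  annotate 0ℙ (applyW f (iterW f n (c0 ∷ [])))      ≡⟨ annotate-f 0ℙ (iterW f n (c0 ∷ [])) ⟩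
  concatMap f̂ (annotate 0ℙ (iterW f n (c0 ∷ [])))   ≡⟨ cong (concatMap f̂) (annotate-fⁿ n) ⟩
  concatMap f̂ (concatMap σ (iterW φ n (d0 ∷ [])))    ≡⟨ concatMap-commute σ φ f̂ σ σ-φ (iterW φ n (d0 ∷ [])) ⟨
  concatMap σ (applyW φ (iterW φ n (d0 ∷ [])))       ∎
  where open ≡-Reasoning

τ∘g∘fⁿ≡ξ∘φⁿ⁺¹ : ∀ n → τFrom 0 (applyW g (iterW f n (c0 ∷ []))) ≡ applyW ξ (iterW φ (suc n) (d0 ∷ []))
τ∘g∘fⁿ≡ξ∘φⁿ⁺¹ n = begin
  τFrom 0 (applyW g (iterW f n (c0 ∷ [])))           ≡⟨ τFrom≡τFromᴾ 0 (applyW g (iterW f n (c0 ∷ []))) ⟩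
  τFromᴾ 0ℙ (applyW g (iterW f n (c0 ∷ [])))         ≡⟨ τFromᴾ-g 0ℙ (iterW f n (c0 ∷ [])) ⟩
  concatMap τĝ (annotate 0ℙ (iterW f n (c0 ∷ [])))  ≡⟨ cong (concatMap τĝ) (annotate-fⁿ n) ⟩
  concatMap τĝ (concatMap σ (iterW φ n (d0 ∷ [])))   ≡⟨ concatMap-commute τĝ σ ξ φ τĝ-σ (iterW φ n (d0 ∷ [])) ⟩
  applyW ξ (iterW φ (suc n) (d0 ∷ []))               ∎
  where open ≡-Reasoning

module FixedPoint-f = FixedPoint f f-expanding c0 c1 [] refl
module FixedPoint-φ = FixedPoint φ φ-expanding d0 d1 [] refl

prefix-y-≼ : ∀ n → prefix y n ≼ applyW g (FixedPoint-f.P n)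
prefix-y-≼ n = prefix-≼ c0 y n (applyW g (FixedPoint-f.P n))
  (≤-trans (n≤1+n n) (≤-trans (FixedPoint-f.length-P n) (length≤length-concatMap g-nonErasing (FixedPoint-f.P n))))
  (λ i i<n → FixedPoint-f.applyS-fixPt g-nonErasing c0 i<n)

z≡ξφ^ω : ∀ i → z i ≡ applyS ξ c0 (fixPt φ d0) i
z≡ξφ^ω i = begin
  lookupD c0 (τPrefix (suc i)) i                              ≡⟨ cong (λ w → lookupD c0 w i) (τPrefix≡τFrom (suc i)) ⟩
  lookupD c0 (τFrom 0 (prefix y (suc i))) i                   ≡⟨ lookupD-≼ c0 (τFrom-≼ 0 (prefix-y-≼ (suc i))) i< ⟨
  lookupD c0 (τFrom 0 (applyW g (FixedPoint-f.P (suc i)))) i  ≡⟨ cong (λ w → lookupD c0 w i) (τ∘g∘fⁿ≡ξ∘φⁿ⁺¹ (suc i)) ⟩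
  lookupD c0 (applyW ξ (FixedPoint-φ.P (suc (suc i)))) i      ≡⟨ FixedPoint-φ.applyS-fixPt ξ-nonErasing c0 (n≤1+n (suc i)) ⟨
  applyS ξ c0 (fixPt φ d0) i                                  ∎
  where
  open ≡-Reasoning
  i< : i < length (τFrom 0 (prefix y (suc i)))
  i< = ≤-trans (≤-reflexive (sym (length-prefix y (suc i)))) (length-τFrom 0 (prefix y (suc i)))

proposition2 : (∀ i → z i ≡ applyS ξ c0 (fixPt φ d0) i) × UniformlyRecurrent z
proposition2 = z≡ξφ^ω , UniformlyRecurrent-cong z≡ξφ^ω ξφ^ω-uniformlyRecurrent
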